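{- For every positive integer $d$, the $d$-Young reducibility digraph $\mathfrak G_d$ is a directed acyclic graph. Consequently, for every $n$, the induced subdigraph $\mathfrak G_{d,n}$ on the Ferrers diagrams of order $n$ is also acyclic.
   Context: A Ferrers diagram is a finite $\mathcal D\subseteq\mathbb N^2$ ($\mathbb N=\{1,2,\dots\}$) with $(x,y)\in\mathcal D\Rightarrow(i,j)\in\mathcal D$ for all $1\le i\le x$, $1\le j\le y$; it has order $n$ if $\mathcal D\subseteq[n]^2$. For $0\le j\le d-1$, $\nu_j(\mathcal D,d)=|\{(x,y)\in\mathcal D:x\ge d-j,\ y\ge j+1\}|$, $\nu_{\min}(\mathcal D,d)=\min_j\nu_j(\mathcal D,d)$. For $P\in\mathcal D$ such that $\mathcal D'=\mathcal D\setminus\{P\}$ is a Ferrers diagram: if $\nu_{\min}(\mathcal D',d)=\nu_{\min}(\mathcal D,d)$ write $\mathcal D'\xrightarrow{d}\mathcal D$, otherwise $\mathcal D\xrightarrow{d}\mathcal D'$. $\mathfrak G_d$ is the directed graph whose vertex set is the set of all Ferrers diagrams (including $\emptyset$) and with an edge $(\mathcal D,\mathcal D')$ iff $\mathcal D\xrightarrow{d}\mathcal D'$. $\mathfrak G_{d,n}$ is its induced subdigraph on Ferrers diagrams of order $n$. -}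

module Defs where

open import Data.Nat using (ℕ; zero; suc; _+_; _∸_; _≤_; _≤ᵇ_; _≡ᵇ_; _⊓_)
open import Data.Bool using (Bool; true; false; _∧_; not; if_then_else_)
open import Data.Product using (Σ; _×_; _,_)
open import Data.Sum using (_⊎_)
open import Relation.Nullary using (¬_)
open import Relation.Binary.PropositionalEquality using (_≡_; _≢_)
open import Relation.Binary.Construct.Closure.Transitive using (TransClosure)

-- A cell of ℕ² ; the paper's ℕ = {1,2,...}, so cells with a 0 coordinate
-- are excluded by the 'positive' field below.
Cell : Set
Cell = ℕ × ℕ

-- A Ferrers diagram: a finite down-closed subset of {1,2,...}², given by a
-- (decidable) membership predicate together with a bound witnessing finiteness.
record Ferrers : Set where
  field
    mem      : ℕ → ℕ → Bool
    bound    : ℕ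
    positive : ∀ x y → mem x y ≡ true → (1 ≤ x) × (1 ≤ y)
    bounded  : ∀ x y → mem x y ≡ true → (x ≤ bound) × (y ≤ bound)
    downward : ∀ x y i j → mem x y ≡ true → 1 ≤ i → i ≤ x → 1 ≤ j → j ≤ y
               → mem i j ≡ true
open Ferrers public

_∈D_ : Cell → Ferrers → Set
(x , y) ∈D D = mem D x y ≡ true

_≈D_ : Ferrers → Ferrers → Set
D ≈D E = ∀ x y → mem D x y ≡ mem E x y

Order : ℕ → Ferrers → Set
Order n D = ∀ x y → mem D x y ≡ true → (x ≤ n) × (y ≤ n)

sumFrom1 : ℕ → (ℕ → ℕ) → ℕ
sumFrom1 zero    f = 0
sumFrom1 (suc m) f = sumFrom1 m f + f (suc m)

countIn : ℕ → (ℕ → ℕ → Bool) → ℕ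
countIn B p = sumFrom1 B (λ x → sumFrom1 B (λ y → if p x y then 1 else 0))

-- ν_j(D,d) = |{(x,y) ∈ D : x ≥ d - j, y ≥ j + 1}|   (used for 0 ≤ j ≤ d-1)
ν : ℕ → ℕ → Ferrers → ℕ
ν d j D = countIn (bound D) (λ x y → mem D x y ∧ ((d ∸ j) ≤ᵇ x) ∧ (suc j ≤ᵇ y))

νminUpTo : ℕ → ℕ → Ferrers → ℕ
νminUpTo d zero    D = ν d 0 D
νminUpTo d (suc k) D = νminUpTo d k D ⊓ ν d (suc k) D

-- ν_min(D,d) = min_{0 ≤ j ≤ d-1} ν_j(D,d)   (only meaningful for d ≥ 1)
νmin : ℕ → Ferrers → ℕ
νmin d D = νminUpTo d (d ∸ 1) D

Removes : Ferrers → Ferrers → Cell → Set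
Removes D E (p , q) =
  (p , q) ∈D D ×
  (∀ x y → mem E x y ≡ (mem D x y ∧ not ((x ≡ᵇ p) ∧ (y ≡ᵇ q))))

Edge : ℕ → Ferrers → Ferrers → Set
Edge d D E =
  (Σ Cell λ P → Removes D E P × (νmin d E ≢ νmin d D))
  ⊎
  (Σ Cell λ P → Removes E D P × (νmin d D ≡ νmin d E))

EdgeOrder : ℕ → ℕ → Ferrers → Ferrers → Set
EdgeOrder d n D E = Order n D × Order n E × Edge d D E

-- A digraph (on Ferrers diagrams, identified up to set equality) is acyclic:
-- there is no directed walk of length ≥ 1 from a vertex back to itself.
Acyclic : (Ferrers → Ferrers → Set) → Set
Acyclic R = ∀ D E → TransClosure R D E → ¬ (D ≈D E)

-- Removing a cell can only lower each ν_j, so along every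
-- edge the pair (ν_min, number of cells) strictly increases in the
-- lexicographic order comparing ν_min downwards and then the cell count
-- upwards. That order is a strict partial order, so no walk returns to its start.
module Submission where

open import Defs
open import Data.Nat using (ℕ; _≤_)
open import Data.Product using (_×_)

open import Data.Nat using (zero; suc; _+_; _∸_; _<_; _>_; _⊓_; z≤n; s≤s; s≤s⁻¹; _≡ᵇ_; _≤ᵇ_)
open import Data.Nat.Properties
open import Data.Bool using (Bool; true; false; _∧_; if_then_else_)
open import Data.Bool.Properties using (∧-conicalˡ)
open import Data.Product using (_,_; proj₁; proj₂)
open import Data.Product.Relation.Binary.Lex.Strict using (×-Lex; ×-isStrictPartialOrder)
open import Data.Sum using (inj₁; inj₂)
open import Relation.Nullary using (yes; no; contradiction)
open import Relation.Binary.Core using (Rel)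
open import Relation.Binary.Structures using (IsStrictPartialOrder)
open import Relation.Binary.PropositionalEquality
open import Relation.Binary.Construct.Closure.Transitive using (TransClosure; [_]; _∷_)
import Relation.Binary.Construct.Flip.EqAndOrd as Flip

sumFrom1-cong : ∀ {f g} → (∀ i → f i ≡ g i) → ∀ m → sumFrom1 m f ≡ sumFrom1 m g
sumFrom1-cong f≡g zero    = refl
sumFrom1-cong f≡g (suc m) = cong₂ _+_ (sumFrom1-cong f≡g m) (f≡g (suc m))

sumFrom1-mono-≤ : ∀ {f g} → (∀ i → f i ≤ g i) → ∀ m → sumFrom1 m f ≤ sumFrom1 m g
sumFrom1-mono-≤ f≤g zero    = z≤n
sumFrom1-mono-≤ f≤g (suc m) = +-mono-≤ (sumFrom1-mono-≤ f≤g m) (f≤g (suc m))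

sumFrom1-mono-< : ∀ {f g} → (∀ i → f i ≤ g i) → ∀ m a → 1 ≤ a → a ≤ m → f a < g a →
                  sumFrom1 m f < sumFrom1 m g
sumFrom1-mono-< f≤g zero    (suc _) _ () _
sumFrom1-mono-< f≤g (suc m) a 1≤a a≤1+m fa<ga with a ≟ suc m
... | yes refl = +-mono-≤-< (sumFrom1-mono-≤ f≤g m) fa<ga
... | no a≢1+m = +-mono-<-≤ (sumFrom1-mono-< f≤g m a 1≤a a≤m fa<ga) (f≤g (suc m))
  where a≤m = s≤s⁻¹ (≤∧≢⇒< a≤1+m a≢1+m)

sumFrom1-vanishing : ∀ {f} C {B} → (∀ i → C < i → f i ≡ 0) → C ≤ B →
                     sumFrom1 B f ≡ sumFrom1 C f
sumFrom1-vanishing {f} C {B} f≡0 C≤B =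
  trans (cong (λ t → sumFrom1 t f) (sym (m+[n∸m]≡n C≤B))) (extend (B ∸ C))
  where
  extend : ∀ k → sumFrom1 (C + k) f ≡ sumFrom1 C f
  extend zero    = cong (λ t → sumFrom1 t f) (+-identityʳ C)
  extend (suc k) rewrite +-suc C k =
    trans (cong₂ _+_ (extend k) (f≡0 (suc (C + k)) (s≤s (m≤m+n C k)))) (+-identityʳ _)

indicator : Bool → ℕ
indicator b = if b then 1 else 0

indicator-mono : ∀ a b → (a ≡ true → b ≡ true) → indicator a ≤ indicator b
indicator-mono false b a⇒b = z≤n
indicator-mono true  b a⇒b rewrite a⇒b refl = ≤-refl

indicator-false : ∀ b → b ≢ true → indicator b ≡ 0
indicator-false false b≢true = refl
indicator-false true  b≢true = contradiction refl b≢true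

Bounded : ℕ → (ℕ → ℕ → Bool) → Set
Bounded C p = ∀ x y → p x y ≡ true → (x ≤ C) × (y ≤ C)

_⇒ᵇ_ : (ℕ → ℕ → Bool) → (ℕ → ℕ → Bool) → Set
p ⇒ᵇ q = ∀ x y → p x y ≡ true → q x y ≡ true

countIn-enlarge : ∀ {p C} B → Bounded C p → C ≤ B → countIn B p ≡ countIn C p
countIn-enlarge {p} {C} B p⊆C C≤B =
  trans (sumFrom1-cong (λ x → sumFrom1-vanishing C (λ y C<y → outside x y C<y proj₂) C≤B) B)
        (sumFrom1-vanishing C (λ x C<x → sumFrom1-vanishing 0 {C}
            (λ y _ → outside x y C<x proj₁) z≤n) C≤B)
  where
  outside : ∀ x y {z} → C < z → ((x ≤ C) × (y ≤ C) → z ≤ C) → indicator (p x y) ≡ 0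
  outside x y C<z coord = indicator-false (p x y) (λ pxy → <⇒≱ C<z (coord (p⊆C x y pxy)))

-- Counts at different bounds are compared at the common bound C + C′.
countIn-mono-≤ : ∀ {p q C C′} → Bounded C p → Bounded C′ q → p ⇒ᵇ q →
                 countIn C p ≤ countIn C′ q
countIn-mono-≤ {p} {q} {C} {C′} p⊆C q⊆C′ p⇒q = begin
  countIn C p        ≡⟨ countIn-enlarge (C + C′) p⊆C (m≤m+n C C′) ⟨
  countIn (C + C′) p ≤⟨ sumFrom1-mono-≤ (λ x → sumFrom1-mono-≤
                          (λ y → indicator-mono (p x y) (q x y) (p⇒q x y)) (C + C′)) (C + C′) ⟩
  countIn (C + C′) q ≡⟨ countIn-enlarge (C + C′) q⊆C′ (m≤n+m C′ C) ⟩
  countIn C′ q       ∎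
  where open ≤-Reasoning

countIn-cong : ∀ {p q C C′} → Bounded C p → Bounded C′ q → (∀ x y → p x y ≡ q x y) →
               countIn C p ≡ countIn C′ q
countIn-cong p⊆C q⊆C′ p≡q = ≤-antisym
  (countIn-mono-≤ p⊆C q⊆C′ (λ x y → trans (sym (p≡q x y))))
  (countIn-mono-≤ q⊆C′ p⊆C (λ x y → trans (p≡q x y)))

countIn-mono-< : ∀ {p q C C′} → Bounded C p → Bounded C′ q → p ⇒ᵇ q →
                 ∀ a b → 1 ≤ a → 1 ≤ b → p a b ≡ false → q a b ≡ true →
                 countIn C p < countIn C′ q
countIn-mono-< {p} {q} {C} {C′} p⊆C q⊆C′ p⇒q a b 1≤a 1≤b ¬pab qab = begin-strict
  countIn C p        ≡⟨ countIn-enlarge (C + C′) p⊆C (m≤m+n C C′) ⟨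
  countIn (C + C′) p <⟨ sumFrom1-mono-< (λ x → sumFrom1-mono-≤ (column≤ x) (C + C′)) (C + C′)
                          a 1≤a a≤ (sumFrom1-mono-< (column≤ a) (C + C′) b 1≤b b≤ indicator<) ⟩
  countIn (C + C′) q ≡⟨ countIn-enlarge (C + C′) q⊆C′ (m≤n+m C′ C) ⟩
  countIn C′ q       ∎
  where
  open ≤-Reasoning
  column≤ : ∀ x y → indicator (p x y) ≤ indicator (q x y)
  column≤ x y = indicator-mono (p x y) (q x y) (p⇒q x y)
  a≤ : a ≤ C + C′
  a≤ = ≤-trans (proj₁ (q⊆C′ a b qab)) (m≤n+m C′ C)
  b≤ : b ≤ C + C′
  b≤ = ≤-trans (proj₂ (q⊆C′ a b qab)) (m≤n+m C′ C)
  indicator< : indicator (p a b) < indicator (q a b)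
  indicator< rewrite ¬pab | qab = s≤s z≤n

card : Ferrers → ℕ
card D = countIn (bound D) (mem D)

_⊆D_ : Ferrers → Ferrers → Set
D ⊆D E = mem D ⇒ᵇ mem E

∧-monoˡ-true : ∀ {a b c} → (a ≡ true → b ≡ true) → a ∧ c ≡ true → b ∧ c ≡ true
∧-monoˡ-true {true} a⇒b a∧c rewrite a⇒b refl = a∧c

restriction-bounded : ∀ D (r : ℕ → ℕ → Bool) → Bounded (bound D) (λ x y → mem D x y ∧ r x y)
restriction-bounded D r x y Dxy∧r = bounded D x y (∧-conicalˡ _ _ Dxy∧r)

νfilter : ℕ → ℕ → ℕ → ℕ → Bool
νfilter d j x y = ((d ∸ j) ≤ᵇ x) ∧ (suc j ≤ᵇ y)

ν-mono : ∀ d j D E → D ⊆D E → ν d j D ≤ ν d j E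
ν-mono d j D E D⊆E =
  countIn-mono-≤ (restriction-bounded D (νfilter d j)) (restriction-bounded E (νfilter d j))
    (λ x y → ∧-monoˡ-true (D⊆E x y))

ν-cong : ∀ d j D E → D ≈D E → ν d j D ≡ ν d j E
ν-cong d j D E D≈E =
  countIn-cong (restriction-bounded D (νfilter d j)) (restriction-bounded E (νfilter d j))
    (λ x y → cong (_∧ _) (D≈E x y))

νminUpTo-mono : ∀ d k D E → D ⊆D E → νminUpTo d k D ≤ νminUpTo d k E
νminUpTo-mono d zero    D E D⊆E = ν-mono d 0 D E D⊆E
νminUpTo-mono d (suc k) D E D⊆E =
  ⊓-mono-≤ (νminUpTo-mono d k D E D⊆E) (ν-mono d (suc k) D E D⊆E)

νminUpTo-cong : ∀ d k D E → D ≈D E → νminUpTo d k D ≡ νminUpTo d k E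
νminUpTo-cong d zero    D E D≈E = ν-cong d 0 D E D≈E
νminUpTo-cong d (suc k) D E D≈E =
  cong₂ _⊓_ (νminUpTo-cong d k D E D≈E) (ν-cong d (suc k) D E D≈E)

card-cong : ∀ D E → D ≈D E → card D ≡ card E
card-cong D E D≈E = countIn-cong (bounded D) (bounded E) D≈E

≡ᵇ-refl : ∀ n → (n ≡ᵇ n) ≡ true
≡ᵇ-refl zero    = refl
≡ᵇ-refl (suc n) = ≡ᵇ-refl n

Removes⇒⊆ : ∀ D E P → Removes D E P → E ⊆D D
Removes⇒⊆ D E P (_ , E≡D∖P) x y Exy = ∧-conicalˡ _ _ (trans (sym (E≡D∖P x y)) Exy)

Removes⇒card-< : ∀ D E P → Removes D E P → card E < card D
Removes⇒card-< D E (p , q) (Dpq , E≡D∖P) =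
  countIn-mono-< (bounded E) (bounded D) (Removes⇒⊆ D E (p , q) (Dpq , E≡D∖P)) p q
    (proj₁ (positive D p q Dpq)) (proj₂ (positive D p q Dpq)) ¬Epq Dpq
  where
  ¬Epq : mem E p q ≡ false
  ¬Epq rewrite E≡D∖P p q | Dpq | ≡ᵇ-refl p | ≡ᵇ-refl q = refl

Acyclic-by-potential : ∀ {a ℓ₁ ℓ₂} {A : Set a} {_≈_ : Rel A ℓ₁} {_≺_ : Rel A ℓ₂} →
  IsStrictPartialOrder _≈_ _≺_ → (φ : Ferrers → A) → (∀ D E → D ≈D E → φ D ≈ φ E) →
  (R : Ferrers → Ferrers → Set) → (∀ D E → R D E → φ D ≺ φ E) → Acyclic R
Acyclic-by-potential {_≺_ = _≺_} spo φ φ-cong R R⇒≺ D E D⁺E D≈E =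
  IsStrictPartialOrder.irrefl spo (φ-cong D E D≈E) (increasing D⁺E)
  where
  increasing : ∀ {D E} → TransClosure R D E → φ D ≺ φ E
  increasing [ DRE ]      = R⇒≺ _ _ DRE
  increasing (DRE ∷ E⁺F) = IsStrictPartialOrder.trans spo (R⇒≺ _ _ DRE) (increasing E⁺F)

potential : ℕ → Ferrers → ℕ × ℕ
potential d D = νmin d D , card D

_≺_ : Rel (ℕ × ℕ) _
_≺_ = ×-Lex _≡_ _>_ _<_

≺-isStrictPartialOrder : IsStrictPartialOrder _ _≺_
≺-isStrictPartialOrder =
  ×-isStrictPartialOrder (Flip.isStrictPartialOrder <-isStrictPartialOrder) <-isStrictPartialOrder

Edge⇒≺ : ∀ d D E → Edge d D E → potential d D ≺ potential d E
Edge⇒≺ d D E (inj₁ (P , D∖P≡E , νmin≢)) =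
  inj₁ (≤∧≢⇒< (νminUpTo-mono d (d ∸ 1) E D (Removes⇒⊆ D E P D∖P≡E)) νmin≢)
Edge⇒≺ d D E (inj₂ (P , E∖P≡D , νmin≡)) = inj₂ (νmin≡ , Removes⇒card-< E D P E∖P≡D)

proposition3p10 : (d : ℕ) → 1 ≤ d → Acyclic (Edge d) × ((n : ℕ) → Acyclic (EdgeOrder d n))
proposition3p10 d _ =
  acyclic (Edge d) (Edge⇒≺ d) ,
  λ n → acyclic (EdgeOrder d n) (λ D E (_ , _ , D→E) → Edge⇒≺ d D E D→E)
  where
  acyclic : (R : Ferrers → Ferrers → Set) →
            (∀ D E → R D E → potential d D ≺ potential d E) → Acyclic R
  acyclic = Acyclic-by-potential ≺-isStrictPartialOrder (potential d)
              (λ D E D≈E → νminUpTo-cong d (d ∸ 1) D E D≈E , card-cong D E D≈E)
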